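{- Let $\Pi$ be a projective plane of order $p^2$, $p\geq3$ prime, let $c\in\mathrm{C}(\Pi)^\perp$ have weight $2p^2-2p+2+\epsilon$ with $1\leq\epsilon\leq p-2$, and let $\mathcal{S}$ be its support. For $A\in\mathcal{S}$ let $x_A$, $y_A$, $z_A$ be the numbers of lines through $A$ meeting $\mathcal{S}$ in exactly $2$, $3$, $4$ points respectively, and let $L_1,\dots,L_m$ be all lines through $A$ meeting $\mathcal{S}$ in at least $4$ points. Then $2x_A+y_A\geq p^2+2p+2-\epsilon$, $3x_A+2y_A+z_A\geq 2p^2+2p+3-\epsilon$, and $x_A=2p+1-\epsilon+\sum_{i=1}^m(|L_i\cap\mathcal{S}|-3)$.
   Context: $\mathrm{C}(\Pi)$ is the $\mathbb{F}_p$-span of the incidence vectors of the lines of $\Pi$, viewed as vectors indexed by points; $\mathrm{C}(\Pi)^\perp$ is the set of vectors $v$ with $\sum_{P\in\ell}v_P=0$ in $\mathbb{F}_p$ for every line $\ell$. The support is the set of points with non-zero entry and the weight is its size. -}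

module Defs where

open import Data.Nat using (ℕ; zero; suc; _+_; _*_; _∸_; _≤_)
open import Data.Nat.Divisibility using (_∣_)
open import Data.Bool using (Bool; true; false; if_then_else_; _∧_; not)
open import Data.Fin using (Fin; zero; suc; toℕ)
open import Data.Fin.Properties using () renaming (_≟_ to _≟ᶠ_)
open import Relation.Nullary using (¬_)
open import Relation.Nullary.Decidable using (⌊_⌋)
open import Relation.Binary.PropositionalEquality using (_≡_; _≢_)
open import Function using (_∘_)

count : ∀ {n} → (Fin n → Bool) → ℕ
count {zero}  f = 0
count {suc n} f = (if f zero then 1 else 0) + count (f ∘ suc)

sumFin : ∀ {n} → (Fin n → ℕ) → ℕ
sumFin {zero}  f = 0
sumFin {suc n} f = f zero + sumFin (f ∘ suc)

size : ℕ → ℕ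
size n = n * n + n + 1

record ProjectivePlane (n : ℕ) : Set where
  field
    inc       : Fin (size n) → Fin (size n) → Bool
    lineSize  : ∀ ℓ → count (λ P → inc P ℓ) ≡ suc n
    pointDeg  : ∀ P → count (λ ℓ → inc P ℓ) ≡ suc n
    twoPoints : ∀ P Q → P ≢ Q → count (λ ℓ → inc P ℓ ∧ inc Q ℓ) ≡ 1
    twoLines  : ∀ ℓ m → ℓ ≢ m → count (λ P → inc P ℓ ∧ inc P m) ≡ 1

Point : ∀ {n} → ProjectivePlane n → Set
Point {n} _ = Fin (size n)

module _ {n : ℕ} (p : ℕ) (Π : ProjectivePlane n) where
  open ProjectivePlane Π

  Line : Set
  Line = Fin (size n)

  -- c ∈ C(Π)^⊥ over F_p  (F_p represented by Fin p)
  InDualCode : (Point Π → Fin p) → Set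
  InDualCode c = ∀ (ℓ : Line) → p ∣ sumFin (λ P → if inc P ℓ then toℕ (c P) else 0)

  inSupport : (Point Π → Fin p) → Point Π → Bool
  inSupport c P = not ⌊ toℕ (c P) Data.Nat.≟ 0 ⌋

  weight : (Point Π → Fin p) → ℕ
  weight c = count (inSupport c)

  meet : (Point Π → Fin p) → Line → ℕ
  meet c ℓ = count (λ P → inc P ℓ ∧ inSupport c P)

  linesThrough : (Point Π → Fin p) → Point Π → ℕ → ℕ
  linesThrough c A k = count (λ ℓ → inc A ℓ ∧ ⌊ meet c ℓ Data.Nat.≟ k ⌋)

  excessSum : (Point Π → Fin p) → Point Π → ℕ
  excessSum c A = sumFin (λ ℓ → if inc A ℓ ∧ ⌊ 4 Data.Nat.≤? meet c ℓ ⌋ then meet c ℓ ∸ 3 else 0)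

{-# OPTIONS --safe #-}
module Submission where

-- Every line ℓ through a point A of the support S meets S at least twice: otherwise the
-- coordinate sum of c along ℓ would be the nonzero residue c(A). Counting the pairs (ℓ, P)
-- with A, P ∈ ℓ and P ∈ S gives Σ_{ℓ ∋ A} |ℓ ∩ S| = |S| + q over the q + 1 lines through A.
-- Each claim is then the sum over these lines of an elementary fact about m = |ℓ ∩ S| ≥ 2,
-- such as [m = 2] + m = 3 + (m ∸ 3), combined with |S| = 2q − 2p + 2 + ε.

open import Defs
open import Data.Nat using (ℕ; zero; suc; _+_; _*_; _∸_; _≤_; z≤n; s≤s; _≟_; _≤?_; NonZero; >-nonZero)
open import Data.Nat.Properties
open import Data.Nat.Divisibility using (_∣_; >⇒∤)
open import Data.Nat.Primality using (Prime)
open import Data.Nat.Tactic.RingSolver using (solve)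
open import Data.Fin using (Fin; zero; suc; toℕ) renaming (_≟_ to _≟ᶠ_)
open import Data.Fin.Properties using (toℕ<n) renaming (suc-injective to fsuc-injective)
open import Data.Bool using (Bool; true; false; _∧_; not; if_then_else_)
open import Data.Bool.Properties using (∧-idem)
open import Data.List using ([]; _∷_)
open import Data.Product using (_×_; _,_)
open import Relation.Nullary using (yes; no; contradiction)
open import Relation.Nullary.Decidable using (⌊_⌋)
open import Relation.Binary.PropositionalEquality
open import Function using (_∘_)
open import Algebra.Properties.Semiring.Sum +-*-semiring
  using (sum; sum-cong-≗; sum-replicate-zero; ∑-distrib-+; ∑-comm; *-distribˡ-sum)

𝟙 : Bool → ℕ
𝟙 b = if b then 1 else 0

if-∧ : ∀ a b x → (if a ∧ b then x else 0) ≡ 𝟙 a * (if b then x else 0)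
if-∧ true  b x = sym (+-identityʳ _)
if-∧ false b x = refl

sumFin≡sum : ∀ {n} (f : Fin n → ℕ) → sumFin f ≡ sum f
sumFin≡sum {zero}  f = refl
sumFin≡sum {suc n} f = cong (f zero +_) (sumFin≡sum (f ∘ suc))

count≡sum-𝟙 : ∀ {n} (g : Fin n → Bool) → count g ≡ sum (𝟙 ∘ g)
count≡sum-𝟙 {zero}  g = refl
count≡sum-𝟙 {suc n} g = cong (𝟙 (g zero) +_) (count≡sum-𝟙 (g ∘ suc))

sum-mono-≤ : ∀ {n} {f g : Fin n → ℕ} → (∀ i → f i ≤ g i) → sum f ≤ sum g
sum-mono-≤ {zero}  f≤g = z≤n
sum-mono-≤ {suc n} f≤g = +-mono-≤ (f≤g zero) (sum-mono-≤ (f≤g ∘ suc))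

sum-single : ∀ {n} (f : Fin n → ℕ) j → (∀ i → i ≢ j → f i ≡ 0) → sum f ≡ f j
sum-single {suc n} f zero    f≡0 = begin
  f zero + sum (f ∘ suc)      ≡⟨ cong (f zero +_) (sum-cong-≗ λ i → f≡0 (suc i) λ ()) ⟩
  f zero + sum {n} (λ _ → 0)  ≡⟨ cong (f zero +_) (sum-replicate-zero n) ⟩
  f zero + 0                  ≡⟨ +-identityʳ (f zero) ⟩
  f zero                      ∎
  where open ≡-Reasoning
sum-single {suc n} f (suc j) f≡0 =
  cong₂ _+_ (f≡0 zero λ ()) (sum-single (f ∘ suc) j λ i i≢j → f≡0 (suc i) (i≢j ∘ fsuc-injective))

count-pos : ∀ {n} (g : Fin n → Bool) {i} → g i ≡ true → 1 ≤ count g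
count-pos g {zero}  gi rewrite gi = s≤s z≤n
count-pos g {suc i} gi = ≤-trans (count-pos (g ∘ suc) gi) (m≤n+m _ (𝟙 (g zero)))

count-pair : ∀ {n} (g : Fin n → Bool) {i j} → g i ≡ true → g j ≡ true → i ≢ j → 2 ≤ count g
count-pair g {zero}  {zero}  _  _  i≢j = contradiction refl i≢j
count-pair g {zero}  {suc j} gi gj _   rewrite gi = s≤s (count-pos (g ∘ suc) gj)
count-pair g {suc i} {zero}  gi gj _   rewrite gj = s≤s (count-pos (g ∘ suc) gi)
count-pair g {suc i} {suc j} gi gj i≢j =
  ≤-trans (count-pair (g ∘ suc) gi gj (i≢j ∘ cong suc)) (m≤n+m _ (𝟙 (g zero)))

sumWhere : ∀ {n} → (Fin n → Bool) → (Fin n → ℕ) → ℕ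
sumWhere g f = sum (λ i → 𝟙 (g i) * f i)

count-∧ : ∀ {n} (g h : Fin n → Bool) → count (λ i → g i ∧ h i) ≡ sumWhere g (𝟙 ∘ h)
count-∧ g h = trans (count≡sum-𝟙 (λ i → g i ∧ h i)) (sum-cong-≗ λ i → if-∧ (g i) (h i) 1)

sumWhere-cong : ∀ {n} (g : Fin n → Bool) {f h : Fin n → ℕ} →
                (∀ i → g i ≡ true → f i ≡ h i) → sumWhere g f ≡ sumWhere g h
sumWhere-cong g f≡h = sum-cong-≗ λ i → guarded (g i) (f≡h i)
  where
  guarded : ∀ b {x y} → (b ≡ true → x ≡ y) → 𝟙 b * x ≡ 𝟙 b * y
  guarded true  x≡y = cong (1 *_) (x≡y refl)
  guarded false _   = refl

sumWhere-mono : ∀ {n} (g : Fin n → Bool) {f h : Fin n → ℕ} →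
                (∀ i → g i ≡ true → f i ≤ h i) → sumWhere g f ≤ sumWhere g h
sumWhere-mono g f≤h = sum-mono-≤ λ i → guarded (g i) (f≤h i)
  where
  guarded : ∀ b {x y} → (b ≡ true → x ≤ y) → 𝟙 b * x ≤ 𝟙 b * y
  guarded true  x≤y = *-monoʳ-≤ 1 (x≤y refl)
  guarded false _   = z≤n

sumWhere-+ : ∀ {n} (g : Fin n → Bool) (f h : Fin n → ℕ) →
             sumWhere g (λ i → f i + h i) ≡ sumWhere g f + sumWhere g h
sumWhere-+ g f h = trans (sum-cong-≗ λ i → *-distribˡ-+ (𝟙 (g i)) (f i) (h i))
                         (∑-distrib-+ (λ i → 𝟙 (g i) * f i) (λ i → 𝟙 (g i) * h i))

sumWhere-* : ∀ {n} (g : Fin n → Bool) k (f : Fin n → ℕ) →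
             sumWhere g (λ i → k * f i) ≡ k * sumWhere g f
sumWhere-* g k f = trans (sum-cong-≗ λ i → swap (𝟙 (g i)) k (f i))
                         (sym (*-distribˡ-sum k (λ i → 𝟙 (g i) * f i)))
  where
  swap : ∀ a b c → a * (b * c) ≡ b * (a * c)
  swap a b c = solve (a ∷ b ∷ c ∷ [])

sumWhere-const : ∀ {n} (g : Fin n → Bool) k → sumWhere g (λ _ → k) ≡ k * count g
sumWhere-const g k = begin
  sum (λ i → 𝟙 (g i) * k)  ≡⟨ sum-cong-≗ (λ i → *-comm (𝟙 (g i)) k) ⟩
  sum (λ i → k * 𝟙 (g i))  ≡⟨ *-distribˡ-sum k (𝟙 ∘ g) ⟨
  k * sum (𝟙 ∘ g)          ≡⟨ cong (k *_) (count≡sum-𝟙 g) ⟨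
  k * count g              ∎
  where open ≡-Reasoning

sum-sift : ∀ {n} (f : Fin n → ℕ) j → sum (λ i → f i * 𝟙 ⌊ i ≟ᶠ j ⌋) ≡ f j
sum-sift f j = trans (sum-single _ j off-j) on-j
  where
  off-j : ∀ i → i ≢ j → f i * 𝟙 ⌊ i ≟ᶠ j ⌋ ≡ 0
  off-j i i≢j with i ≟ᶠ j
  ... | yes i≡j = contradiction i≡j i≢j
  ... | no  _   = *-zeroʳ (f i)
  on-j : f j * 𝟙 ⌊ j ≟ᶠ j ⌋ ≡ f j
  on-j with j ≟ᶠ j
  ... | yes _   = *-identityʳ (f j)
  ... | no  j≢j = contradiction refl j≢j

module _ {n : ℕ} (Π : ProjectivePlane n) where
  open ProjectivePlane Π

  lines-joining : ∀ A P → count (λ ℓ → inc A ℓ ∧ inc P ℓ) ≡ 1 + n * 𝟙 ⌊ P ≟ᶠ A ⌋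
  lines-joining A P with P ≟ᶠ A
  ... | no  P≢A  = trans (twoPoints A P (P≢A ∘ sym)) (cong suc (sym (*-zeroʳ n)))
  ... | yes refl = begin
    count (λ ℓ → inc A ℓ ∧ inc A ℓ)    ≡⟨ count≡sum-𝟙 (λ ℓ → inc A ℓ ∧ inc A ℓ) ⟩
    sum (λ ℓ → 𝟙 (inc A ℓ ∧ inc A ℓ))  ≡⟨ sum-cong-≗ (λ ℓ → cong 𝟙 (∧-idem (inc A ℓ))) ⟩
    sum (𝟙 ∘ inc A)                    ≡⟨ count≡sum-𝟙 (inc A) ⟨
    count (inc A)                      ≡⟨ pointDeg A ⟩
    suc n                              ≡⟨ cong suc (*-identityʳ n) ⟨
    1 + n * 1                          ∎
    where open ≡-Reasoning

  sum-through-meet : ∀ (S : Point Π → Bool) A →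
    sumWhere (inc A) (λ ℓ → count (λ P → inc P ℓ ∧ S P)) ≡ count S + n * 𝟙 (S A)
  sum-through-meet S A = begin
    sum (λ ℓ → 𝟙 (inc A ℓ) * count (λ P → inc P ℓ ∧ S P))
      ≡⟨ sum-cong-≗ (λ ℓ → cong (𝟙 (inc A ℓ) *_) (count-∧ (λ P → inc P ℓ) S)) ⟩
    sum (λ ℓ → 𝟙 (inc A ℓ) * sum (λ P → 𝟙 (inc P ℓ) * 𝟙 (S P)))
      ≡⟨ sum-cong-≗ (λ ℓ → *-distribˡ-sum (𝟙 (inc A ℓ)) (λ P → 𝟙 (inc P ℓ) * 𝟙 (S P))) ⟩
    sum (λ ℓ → sum (λ P → 𝟙 (inc A ℓ) * (𝟙 (inc P ℓ) * 𝟙 (S P))))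
      ≡⟨ ∑-comm (λ ℓ P → 𝟙 (inc A ℓ) * (𝟙 (inc P ℓ) * 𝟙 (S P))) ⟩
    sum (λ P → sum (λ ℓ → 𝟙 (inc A ℓ) * (𝟙 (inc P ℓ) * 𝟙 (S P))))
      ≡⟨ sum-cong-≗ (λ P → sum-cong-≗ (λ ℓ → rotate (𝟙 (inc A ℓ)) (𝟙 (inc P ℓ)) (𝟙 (S P)))) ⟩
    sum (λ P → sum (λ ℓ → 𝟙 (S P) * (𝟙 (inc A ℓ) * 𝟙 (inc P ℓ))))
      ≡⟨ sum-cong-≗ (λ P → *-distribˡ-sum (𝟙 (S P)) (λ ℓ → 𝟙 (inc A ℓ) * 𝟙 (inc P ℓ))) ⟨
    sum (λ P → 𝟙 (S P) * sumWhere (inc A) (𝟙 ∘ inc P))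
      ≡⟨ sum-cong-≗ (λ P → cong (𝟙 (S P) *_)
                             (trans (sym (count-∧ (inc A) (inc P))) (lines-joining A P))) ⟩
    sum (λ P → 𝟙 (S P) * (1 + n * 𝟙 ⌊ P ≟ᶠ A ⌋))
      ≡⟨ sum-cong-≗ (λ P → expand (𝟙 (S P)) (𝟙 ⌊ P ≟ᶠ A ⌋)) ⟩
    sum (λ P → 𝟙 (S P) + n * (𝟙 (S P) * 𝟙 ⌊ P ≟ᶠ A ⌋))
      ≡⟨ ∑-distrib-+ (𝟙 ∘ S) (λ P → n * (𝟙 (S P) * 𝟙 ⌊ P ≟ᶠ A ⌋)) ⟩
    sum (𝟙 ∘ S) + sum (λ P → n * (𝟙 (S P) * 𝟙 ⌊ P ≟ᶠ A ⌋))
      ≡⟨ cong₂ _+_ (count≡sum-𝟙 S) (*-distribˡ-sum n (λ P → 𝟙 (S P) * 𝟙 ⌊ P ≟ᶠ A ⌋)) ⟨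
    count S + n * sum (λ P → 𝟙 (S P) * 𝟙 ⌊ P ≟ᶠ A ⌋)
      ≡⟨ cong (λ t → count S + n * t) (sum-sift (𝟙 ∘ S) A) ⟩
    count S + n * 𝟙 (S A)
      ∎
    where
    open ≡-Reasoning
    rotate : ∀ a b s → a * (b * s) ≡ s * (a * b)
    rotate a b s = solve (a ∷ b ∷ s ∷ [])
    expand : ∀ s d → s * (1 + n * d) ≡ s + n * (s * d)
    expand s d = solve (s ∷ d ∷ n ∷ [])

excess-guard : ∀ m → (if ⌊ 4 ≤? m ⌋ then m ∸ 3 else 0) ≡ m ∸ 3
excess-guard 0 = refl
excess-guard 1 = refl
excess-guard 2 = refl
excess-guard 3 = refl
excess-guard (suc (suc (suc (suc _)))) = refl

secant-identity : ∀ {m} → 2 ≤ m → 𝟙 ⌊ m ≟ 2 ⌋ + m ≡ 3 + (m ∸ 3)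
secant-identity {0} ()
secant-identity {1} (s≤s ())
secant-identity {2} _ = refl
secant-identity {3} _ = refl
secant-identity {suc (suc (suc (suc _)))} _ = refl

secant-bound₁ : ∀ {m} → 2 ≤ m → 4 ≤ 2 * 𝟙 ⌊ m ≟ 2 ⌋ + 𝟙 ⌊ m ≟ 3 ⌋ + m
secant-bound₁ {0} ()
secant-bound₁ {1} (s≤s ())
secant-bound₁ {2} _ = ≤-refl
secant-bound₁ {3} _ = ≤-refl
secant-bound₁ {suc (suc (suc (suc m)))} _ = m≤m+n 4 m

secant-bound₂ : ∀ {m} → 2 ≤ m → 5 ≤ 3 * 𝟙 ⌊ m ≟ 2 ⌋ + 2 * 𝟙 ⌊ m ≟ 3 ⌋ + 𝟙 ⌊ m ≟ 4 ⌋ + m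
secant-bound₂ {0} ()
secant-bound₂ {1} (s≤s ())
secant-bound₂ {2} _ = ≤-refl
secant-bound₂ {3} _ = ≤-refl
secant-bound₂ {4} _ = ≤-refl
secant-bound₂ {suc (suc (suc (suc (suc m))))} _ = m≤m+n 5 m

flagged⇒nonZero : ∀ x → not ⌊ x ≟ 0 ⌋ ≡ true → NonZero x
flagged⇒nonZero (suc x) _ = _

unflagged⇒zero : ∀ x → not ⌊ x ≟ 0 ⌋ ≡ false → x ≡ 0
unflagged⇒zero zero _ = refl

module _ {n : ℕ} (p : ℕ) (Π : ProjectivePlane n) (c : Point Π → Fin p) where
  open ProjectivePlane Π

  meet≥2 : InDualCode p Π c → ∀ {A ℓ} → inSupport p Π c A ≡ true → inc A ℓ ≡ true →
           2 ≤ meet p Π c ℓ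
  meet≥2 dual {A} {ℓ} A∈S A∈ℓ with 2 ≤? meet p Π c ℓ
  ... | yes 2≤m = 2≤m
  ... | no  2≰m = contradiction (subst (p ∣_) line-sum≡cA (dual ℓ))
                                (>⇒∤ ⦃ flagged⇒nonZero (toℕ (c A)) A∈S ⦄ (toℕ<n (c A)))
    where
    value : Point Π → ℕ
    value P = if inc P ℓ then toℕ (c P) else 0
    off-A : ∀ B → B ≢ A → value B ≡ 0
    off-A B B≢A with inc B ℓ in B∈ℓ | inSupport p Π c B in B∈S
    ... | false | _     = refl
    ... | true  | false = unflagged⇒zero (toℕ (c B)) B∈S
    ... | true  | true  =
      contradiction (count-pair _ (cong₂ _∧_ A∈ℓ A∈S) (cong₂ _∧_ B∈ℓ B∈S) (B≢A ∘ sym)) 2≰m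
    line-sum≡cA : sumFin value ≡ toℕ (c A)
    line-sum≡cA = begin
      sumFin value  ≡⟨ sumFin≡sum value ⟩
      sum value     ≡⟨ sum-single value A off-A ⟩
      value A       ≡⟨ cong (λ b → if b then toℕ (c A) else 0) A∈ℓ ⟩
      toℕ (c A)     ∎
      where open ≡-Reasoning

  module _ (dual : InDualCode p Π c) {A : Point Π} (A∈S : inSupport p Π c A ≡ true) where
    private
      m : Line p Π → ℕ
      m = meet p Π c
      secants : ℕ → Line p Π → ℕ
      secants k ℓ = 𝟙 ⌊ m ℓ ≟ k ⌋
      x : ℕ → ℕ
      x = linesThrough p Π c A
      Σm : ℕ
      Σm = sumWhere (inc A) m
      Σsecants : ℕ → ℕ
      Σsecants k = sumWhere (inc A) (secants k)
      m≥2 : ∀ ℓ → inc A ℓ ≡ true → 2 ≤ m ℓ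
      m≥2 ℓ = meet≥2 dual A∈S

    linesThrough≡sumWhere : ∀ k → x k ≡ Σsecants k
    linesThrough≡sumWhere k = count-∧ (inc A) (λ ℓ → ⌊ m ℓ ≟ k ⌋)

    excessSum≡sumWhere : excessSum p Π c A ≡ sumWhere (inc A) (λ ℓ → m ℓ ∸ 3)
    excessSum≡sumWhere = trans (sumFin≡sum guarded) (sum-cong-≗ λ ℓ →
      trans (if-∧ (inc A ℓ) _ (m ℓ ∸ 3)) (cong (𝟙 (inc A ℓ) *_) (excess-guard (m ℓ))))
      where
      guarded : Line p Π → ℕ
      guarded ℓ = if inc A ℓ ∧ ⌊ 4 ≤? m ℓ ⌋ then m ℓ ∸ 3 else 0

    sum-through-const : ∀ k → sumWhere (inc A) (λ _ → k) ≡ k * (1 + n)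
    sum-through-const k = trans (sumWhere-const (inc A) k) (cong (k *_) (pointDeg A))

    sum-through-meet-support : Σm ≡ weight p Π c + n
    sum-through-meet-support = begin
      Σm                                        ≡⟨ sum-through-meet Π (inSupport p Π c) A ⟩
      weight p Π c + n * 𝟙 (inSupport p Π c A)  ≡⟨ cong (λ b → weight p Π c + n * 𝟙 b) A∈S ⟩
      weight p Π c + n * 1                      ≡⟨ cong (weight p Π c +_) (*-identityʳ n) ⟩
      weight p Π c + n                          ∎
      where open ≡-Reasoning

    linesThrough₂+weight : x 2 + (weight p Π c + n) ≡ 3 * (1 + n) + excessSum p Π c A
    linesThrough₂+weight = begin
      x 2 + (weight p Π c + n)
        ≡⟨ cong (x 2 +_) sum-through-meet-support ⟨
      x 2 + Σm
        ≡⟨ cong (_+ Σm) (linesThrough≡sumWhere 2) ⟩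
      Σsecants 2 + Σm
        ≡⟨ sumWhere-+ (inc A) (secants 2) m ⟨
      sumWhere (inc A) (λ ℓ → secants 2 ℓ + m ℓ)
        ≡⟨ sumWhere-cong (inc A) (λ ℓ → secant-identity ∘ m≥2 ℓ) ⟩
      sumWhere (inc A) (λ ℓ → 3 + (m ℓ ∸ 3))
        ≡⟨ sumWhere-+ (inc A) (λ _ → 3) (λ ℓ → m ℓ ∸ 3) ⟩
      sumWhere (inc A) (λ _ → 3) + sumWhere (inc A) (λ ℓ → m ℓ ∸ 3)
        ≡⟨ cong₂ _+_ (sum-through-const 3) (sym excessSum≡sumWhere) ⟩
      3 * (1 + n) + excessSum p Π c A
        ∎
      where open ≡-Reasoning

    linesThrough-bound₂₃ : 4 * (1 + n) ≤ 2 * x 2 + x 3 + (weight p Π c + n)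
    linesThrough-bound₂₃ = begin
      4 * (1 + n)
        ≡⟨ sum-through-const 4 ⟨
      sumWhere (inc A) (λ _ → 4)
        ≤⟨ sumWhere-mono (inc A) (λ ℓ → secant-bound₁ ∘ m≥2 ℓ) ⟩
      sumWhere (inc A) (λ ℓ → 2 * secants 2 ℓ + secants 3 ℓ + m ℓ)
        ≡⟨ sumWhere-+ (inc A) (λ ℓ → 2 * secants 2 ℓ + secants 3 ℓ) m ⟩
      sumWhere (inc A) (λ ℓ → 2 * secants 2 ℓ + secants 3 ℓ) + Σm
        ≡⟨ cong (_+ Σm) (sumWhere-+ (inc A) (λ ℓ → 2 * secants 2 ℓ) (secants 3)) ⟩
      sumWhere (inc A) (λ ℓ → 2 * secants 2 ℓ) + Σsecants 3 + Σm
        ≡⟨ cong (λ t → t + Σsecants 3 + Σm) (sumWhere-* (inc A) 2 (secants 2)) ⟩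
      2 * Σsecants 2 + Σsecants 3 + Σm
        ≡⟨ cong₂ (λ s t → 2 * s + t + Σm) (linesThrough≡sumWhere 2) (linesThrough≡sumWhere 3) ⟨
      2 * x 2 + x 3 + Σm
        ≡⟨ cong (2 * x 2 + x 3 +_) sum-through-meet-support ⟩
      2 * x 2 + x 3 + (weight p Π c + n)
        ∎
      where open ≤-Reasoning

    linesThrough-bound₂₃₄ : 5 * (1 + n) ≤ 3 * x 2 + 2 * x 3 + x 4 + (weight p Π c + n)
    linesThrough-bound₂₃₄ = begin
      5 * (1 + n)
        ≡⟨ sum-through-const 5 ⟨
      sumWhere (inc A) (λ _ → 5)
        ≤⟨ sumWhere-mono (inc A) (λ ℓ → secant-bound₂ ∘ m≥2 ℓ) ⟩
      sumWhere (inc A) (λ ℓ → 3 * secants 2 ℓ + 2 * secants 3 ℓ + secants 4 ℓ + m ℓ)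
        ≡⟨ sumWhere-+ (inc A) (λ ℓ → 3 * secants 2 ℓ + 2 * secants 3 ℓ + secants 4 ℓ) m ⟩
      sumWhere (inc A) (λ ℓ → 3 * secants 2 ℓ + 2 * secants 3 ℓ + secants 4 ℓ) + Σm
        ≡⟨ cong (_+ Σm) (sumWhere-+ (inc A) (λ ℓ → 3 * secants 2 ℓ + 2 * secants 3 ℓ) (secants 4)) ⟩
      sumWhere (inc A) (λ ℓ → 3 * secants 2 ℓ + 2 * secants 3 ℓ) + Σsecants 4 + Σm
        ≡⟨ cong (λ t → t + Σsecants 4 + Σm)
                (sumWhere-+ (inc A) (λ ℓ → 3 * secants 2 ℓ) (λ ℓ → 2 * secants 3 ℓ)) ⟩
      sumWhere (inc A) (λ ℓ → 3 * secants 2 ℓ) + sumWhere (inc A) (λ ℓ → 2 * secants 3 ℓ)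
        + Σsecants 4 + Σm
        ≡⟨ cong₂ (λ s t → s + t + Σsecants 4 + Σm)
                 (sumWhere-* (inc A) 3 (secants 2)) (sumWhere-* (inc A) 2 (secants 3)) ⟩
      3 * Σsecants 2 + 2 * Σsecants 3 + Σsecants 4 + Σm
        ≡⟨ cong₂ (λ s t → 3 * s + 2 * t + Σsecants 4 + Σm)
                 (linesThrough≡sumWhere 2) (linesThrough≡sumWhere 3) ⟨
      3 * x 2 + 2 * x 3 + Σsecants 4 + Σm
        ≡⟨ cong (λ t → 3 * x 2 + 2 * x 3 + t + Σm) (linesThrough≡sumWhere 4) ⟨
      3 * x 2 + 2 * x 3 + x 4 + Σm
        ≡⟨ cong (3 * x 2 + 2 * x 3 + x 4 +_) sum-through-meet-support ⟩
      3 * x 2 + 2 * x 3 + x 4 + (weight p Π c + n)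
        ∎
      where open ≤-Reasoning

∸-trade-≤ : ∀ {k b N} a c d ε → N + d ≡ c + ε → k ≤ b + N → a + c ≡ k + d → a ∸ ε ≤ b
∸-trade-≤ {k} {b} {N} a c d ε N+d≡c+ε k≤b+N a+c≡k+d =
  m≤n+o⇒m∸n≤o a ε (+-cancelʳ-≤ c a (ε + b) (begin
    a + c        ≡⟨ a+c≡k+d ⟩
    k + d        ≤⟨ +-monoˡ-≤ d k≤b+N ⟩
    b + N + d    ≡⟨ +-assoc b N d ⟩
    b + (N + d)  ≡⟨ cong (b +_) N+d≡c+ε ⟩
    b + (c + ε)  ≡⟨ solve (b ∷ c ∷ ε ∷ []) ⟩
    ε + b + c    ∎))
  where open ≤-Reasoning

∸-trade-≡ : ∀ {x N K E} a c d ε → ε ≤ a → N + d ≡ c + ε → x + N ≡ K + E → K + d ≡ c + a →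
            x ≡ a ∸ ε + E
∸-trade-≡ {x} {N} {K} {E} a c d ε ε≤a N+d≡c+ε x+N≡K+E K+d≡c+a = begin
  x              ≡⟨ m+n∸n≡m x ε ⟨
  x + ε ∸ ε      ≡⟨ cong (_∸ ε) x+ε≡a+E ⟩
  a + E ∸ ε      ≡⟨ +-∸-comm E ε≤a ⟩
  a ∸ ε + E      ∎
  where
  open ≡-Reasoning
  x+ε≡a+E : x + ε ≡ a + E
  x+ε≡a+E = +-cancelʳ-≡ c (x + ε) (a + E) (begin
    x + ε + c        ≡⟨ solve (x ∷ ε ∷ c ∷ []) ⟩
    x + (c + ε)      ≡⟨ cong (x +_) N+d≡c+ε ⟨
    x + (N + d)      ≡⟨ +-assoc x N d ⟨
    x + N + d        ≡⟨ cong (_+ d) x+N≡K+E ⟩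
    K + E + d        ≡⟨ solve (K ∷ E ∷ d ∷ []) ⟩
    K + d + E        ≡⟨ cong (_+ E) K+d≡c+a ⟩
    c + a + E        ≡⟨ solve (c ∷ a ∷ E ∷ []) ⟩
    a + E + c        ∎)

weight-shift : ∀ {w} q p ε → 2 * p ≤ 2 * q → w ≡ 2 * q ∸ 2 * p + 2 + ε →
               w + q + 2 * p ≡ 3 * q + 2 + ε
weight-shift {w} q p ε 2p≤2q w≡ = begin
  w + q + 2 * p                        ≡⟨ cong (λ v → v + q + 2 * p) w≡ ⟩
  (2 * q ∸ 2 * p) + 2 + ε + q + 2 * p  ≡⟨ regroup (2 * q ∸ 2 * p) ⟩
  (2 * q ∸ 2 * p) + 2 * p + q + 2 + ε  ≡⟨ cong (λ t → t + q + 2 + ε) (m∸n+n≡m 2p≤2q) ⟩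
  2 * q + q + 2 + ε                    ≡⟨ solve (q ∷ ε ∷ []) ⟩
  3 * q + 2 + ε                        ∎
  where
  open ≡-Reasoning
  regroup : ∀ t → t + 2 + ε + q + 2 * p ≡ t + 2 * p + q + 2 + ε
  regroup t = solve (t ∷ p ∷ q ∷ ε ∷ [])

mainTheorem19 : (p : ℕ) → Prime p → 3 ≤ p →
    (Π : ProjectivePlane (p * p)) → (c : Point Π → Fin p) → InDualCode p Π c →
    (ε : ℕ) → 1 ≤ ε → ε ≤ p ∸ 2 →
    weight p Π c ≡ 2 * (p * p) ∸ 2 * p + 2 + ε →
    (A : Point Π) → inSupport p Π c A ≡ true →
    (p * p + 2 * p + 2 ∸ ε ≤ 2 * linesThrough p Π c A 2 + linesThrough p Π c A 3)
    × (2 * (p * p) + 2 * p + 3 ∸ ε ≤ 3 * linesThrough p Π c A 2 + 2 * linesThrough p Π c A 3 + linesThrough p Π c A 4)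
    × (linesThrough p Π c A 2 ≡ 2 * p + 1 ∸ ε + excessSum p Π c A)
mainTheorem19 p _ 3≤p Π c dual ε _ ε≤p∸2 weight≡ A A∈S =
    ∸-trade-≤ (p * p + 2 * p + 2) (3 * (p * p) + 2) (2 * p) ε shift
              (linesThrough-bound₂₃ p Π c dual A∈S) (solve (p ∷ []))
  , ∸-trade-≤ (2 * (p * p) + 2 * p + 3) (3 * (p * p) + 2) (2 * p) ε shift
              (linesThrough-bound₂₃₄ p Π c dual A∈S) (solve (p ∷ []))
  , ∸-trade-≡ (2 * p + 1) (3 * (p * p) + 2) (2 * p) ε ε≤2p+1 shift
              (linesThrough₂+weight p Π c dual A∈S) (solve (p ∷ []))
  where
  ε≤2p+1 : ε ≤ 2 * p + 1
  ε≤2p+1 = ≤-trans ε≤p∸2 (≤-trans (m∸n≤m p 2) (≤-trans (m≤m+n p (p + 0)) (m≤m+n (2 * p) 1)))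
  1≤p : 1 ≤ p
  1≤p = ≤-trans (s≤s z≤n) 3≤p
  shift : weight p Π c + p * p + 2 * p ≡ 3 * (p * p) + 2 + ε
  shift = weight-shift (p * p) p ε (*-monoʳ-≤ 2 (m≤m*n p p ⦃ >-nonZero 1≤p ⦄)) weight≡
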